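{- Let $\mathbb{A}=(A,R_1,\dots,R_n)$ and $\mathbb{B}=(A,S_1,\dots,S_m)$ be two relational structures on the same set $A$, and let $I=(V,\mathcal{C})$ be an instance of $\mathrm{CSP}(\mathbb{A})$. Let $r,s$ be positive integers and $J=(W,\mathcal{D})$ an instance of $\mathrm{CSP}(\mathbb{B})$ such that $\mathcal{S}^s_{\mathbb{A}}(I)\vdash J$ and $\mathcal{S}^r_{\mathbb{B}}(J)\vdash G$. Then $\mathcal{S}^{r+s}_{\mathbb{A}}(I)\vdash G$.
   Context: A relational structure $\mathbb{A}=(A,\mathcal{R})$ is a finite set $A$ with finitely many basic relations of positive finite arity. An instance $I=(V,\mathcal{C})$ of $\mathrm{CSP}(\mathbb{A})$ is a finite set $V$ of variables and constraints $(\sigma,R)$ with $R$ an $n$-ary basic relation and $\sigma\in V^n$. The $r$-ary maximal symmetric Datalog program $\mathcal{S}^r_{\mathbb{A}}$: IDB predicates are all relations on $A$ of arity at most $r$, plus a non-IDB symbol for each basic relation of $\mathbb{A}$ of arity at most $r$. Rules $R(\rho)\leftarrow S_1(\sigma_1),\dots,S_\ell(\sigma_\ell)$ are all rules that (1) have an IDB on the left and at most one IDB on the right, (2) use only variables from $\{x_1,\dots,x_r\}$, (3) have no repeated atom on the right, (4) are consistent with $\mathbb{A}$: for every $f\colon\{x_1,\dots,x_r\}\to A$, if $f(\sigma_i)\in S_i$ for all $i$ then $f(\rho)\in R$, and (5) if the right side contains an IDB atom, the rule with the left atom and that right IDB atom exchanged is also consistent. Goal predicates: empty relations of arity at most $r$.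 Derivation: $\mathcal{S}^r_{\mathbb{A}}(I)\vdash R(\rho)$ if $(\rho,R)\in\mathcal C$, or there is a rule $R(\tau)\leftarrow S_1(\sigma_1),\dots,S_\ell(\sigma_\ell)$ and a map $\omega$ from program variables to $V$ with $\omega(\tau)=\rho$ and $\mathcal{S}^r_{\mathbb{A}}(I)\vdash S_i(\omega(\sigma_i))$ for all $i$; $\vdash G$ means some goal predicate is derived on some tuple. For an instance $J=(W,\mathcal D)$ (with constraint relations being relations on $A$), $\mathcal{S}^s_{\mathbb{A}}(I)\vdash J$ means $W\subseteq V$ and for each $(\sigma,R)\in\mathcal D$ we have $\mathcal{S}^s_{\mathbb{A}}(I)\vdash R(\sigma)$ (with $R$ as an IDB predicate). -}

module Defs where

open import Data.Nat using (ℕ; zero; suc; _≤_; _<_; _+_)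
open import Data.Fin using (Fin)
open import Data.Bool using (Bool; true; false)
open import Data.List using (List; []; _∷_; length; lookup; _[_]∷=_)
open import Data.List.Relation.Unary.All using (All)
open import Data.List.Relation.Unary.Unique.Propositional using (Unique)
open import Data.List.Membership.Propositional using (_∈_)
open import Data.Vec using (Vec; map)
open import Data.Product using (Σ; _×_; _,_; proj₁; proj₂)
open import Relation.Binary.PropositionalEquality using (_≡_)

-- The domain A is Fin a.  An n-ary relation on A is a (decidable, i.e.
-- Bool-valued) subset of A^n; since A is finite this is every subset.

Rel : ℕ → ℕ → Set
Rel a n = Vec (Fin a) n → Bool

-- A relational structure on A: a finite list of basic relations, each of
-- positive arity (an entry (k , R) is a relation of arity suc k).
Struct : ℕ → Set
Struct a = List (Σ ℕ (λ k → Rel a (suc k)))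

module _ {a : ℕ} (𝔸 : Struct a) where

  arity : Fin (length 𝔸) → ℕ
  arity i = suc (proj₁ (lookup 𝔸 i))

  basic : (i : Fin (length 𝔸)) → Rel a (arity i)
  basic i = proj₂ (lookup 𝔸 i)

  -- Instances of CSP(𝔸).  Variables are drawn from an ambient type X;
  -- the (finite) variable set V is a list, every constraint (σ , R_i)
  -- has σ ∈ V^{arity i}.

  Constraint : Set → Set
  Constraint X = Σ (Fin (length 𝔸)) (λ i → Vec X (arity i))

  record Instance (X : Set) : Set where
    field
      vars    : List X
      cons    : List (Constraint X)
      cons-ok : All (λ c → ∀ k → Data.Vec.lookup (proj₂ c) k ∈ vars) cons
  open Instance public

  -- The r-ary maximal symmetric Datalog program S^r_𝔸.

  -- Predicate symbols of arity n: IDBs (all relations of arity ≤ r) and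
  -- non-IDB symbols for the basic relations of arity ≤ r.
  data Sym (r : ℕ) : ℕ → Set where
    idb : ∀ {n} → n ≤ r → Rel a n → Sym r n
    edb : (i : Fin (length 𝔸)) → arity i ≤ r → Sym r (arity i)

  ⟦_⟧ : ∀ {r n} → Sym r n → Rel a n
  ⟦ idb _ R ⟧ = R
  ⟦ edb i _ ⟧ = basic i

  -- atoms with arguments in Y (program variables: Y = Fin r)
  data Atom (r : ℕ) (Y : Set) : Set where
    _⟨_⟩ : ∀ {n} → Sym r n → Vec Y n → Atom r Y

  data IsIDB {r Y} : Atom r Y → Set where
    isIDB : ∀ {n} {le : n ≤ r} {R : Rel a n} {σ : Vec Y n} → IsIDB (idb le R ⟨ σ ⟩)

  isIDBᵇ : ∀ {r Y} → Atom r Y → Bool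
  isIDBᵇ (idb _ _ ⟨ _ ⟩) = true
  isIDBᵇ (edb _ _ ⟨ _ ⟩) = false

  nIDB : ∀ {r Y} → List (Atom r Y) → ℕ
  nIDB [] = 0
  nIDB (x ∷ xs) with isIDBᵇ x
  ... | true  = suc (nIDB xs)
  ... | false = nIDB xs

  rename : ∀ {r Y Z} → (Y → Z) → Atom r Y → Atom r Z
  rename ω (S ⟨ σ ⟩) = S ⟨ map ω σ ⟩

  Holds : ∀ {r} → (Fin r → Fin a) → Atom r (Fin r) → Set
  Holds f (S ⟨ σ ⟩) = ⟦ S ⟧ (map f σ) ≡ true

  Consistent : ∀ {r} → Atom r (Fin r) → List (Atom r (Fin r)) → Set
  Consistent {r} hd bd = (f : Fin r → Fin a) → All (Holds f) bd → Holds f hd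

  record Rule (r : ℕ) : Set where
    field
      head     : Atom r (Fin r)
      body     : List (Atom r (Fin r))
      head-idb : IsIDB head
      one-idb  : nIDB body ≤ 1
      distinct : Unique body
      consistent : Consistent head body
      swap-consistent : (k : Fin (length body)) →
        IsIDB (lookup body k) → Consistent (lookup body k) (body [ k ]∷= head)
  open Rule public

  data Derives {X : Set} (I : Instance X) (r : ℕ) : Atom r X → Set where
    base  : ∀ {i σ} (le : arity i ≤ r) → (i , σ) ∈ cons I →
            Derives I r (edb i le ⟨ σ ⟩)
    apply : (ρ : Rule r) (ω : Fin r → X) → (∀ x → ω x ∈ vars I) →
            All (λ at → Derives I r (rename ω at)) (body ρ) →
            Derives I r (rename ω (head ρ))

  -- S^r_𝔸(I) ⊢ G : some goal predicate (empty relation of arity ≤ r) is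
  -- derived on some tuple
  DerivesGoal : {X : Set} → Instance X → ℕ → Set
  DerivesGoal {X} I r =
    Σ ℕ λ n → Σ (n ≤ r) λ le → Σ (Rel a n) λ R →
      ((t : Vec (Fin a) n) → R t ≡ false) ×
      Σ (Vec X n) λ ρ → Derives I r (idb le R ⟨ ρ ⟩)

-- S^s_𝔸(I) ⊢ J  for an instance J of CSP(𝔹) (𝔹 on the same set A):
-- W ⊆ V and every constraint (σ , S_j) of J is derived with S_j as an IDB.
DerivesInst : ∀ {a} (𝔸 𝔹 : Struct a) {X : Set} →
  Instance 𝔸 X → ℕ → Instance 𝔹 X → Set
DerivesInst 𝔸 𝔹 I s J =
  (∀ w → w ∈ vars J → w ∈ vars I) ×
  All (λ c → Σ (arity 𝔹 (proj₁ c) ≤ s) λ le →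
               Derives 𝔸 I s (idb le (basic 𝔹 (proj₁ c)) ⟨ proj₂ c ⟩))
      (cons J)

module Submission where

-- Split the variables of S^{r+s}_𝔸 into an x-block of size r and a y-block of
-- size s.  By induction (`simulate`), every IDB atom S(ν) derived by S^r_𝔹
-- from J is derived by S^{r+s}_𝔸 from I with S as an IDB.  An application of a
-- rule h ← y, E of S^r_𝔹 at ω is replayed in the x-block: a link rule derives
-- "h where E holds, y elsewhere" at ω, and each EDB atom of E is then removed,
-- since at ω it is a constraint of J, hence an IDB fact U(ν) of S^s_𝔸(I).  The
-- passenger lemma reruns that width-s derivation in the y-block carrying an
-- r-ary fact M(χ) along, forwards and (by symmetry of the program) backwards,
-- so U(ν) trades M₁(χ) for any M₂(χ) agreeing with M₁ where U holds (`transfer`).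

open import Defs
open import Data.Nat using (ℕ; _+_; _<_; _≤_; _≤?_; z≤n; s≤s)
open import Data.Nat.Properties using (≤-trans; ≤-irrelevant; m≤m+n; m≤n+m; +-monoʳ-≤)
open import Data.Fin using (Fin; zero; suc; fromℕ<; splitAt; _↑ˡ_; _↑ʳ_)
open import Data.Bool using (Bool; true; false; _∧_; if_then_else_)
open import Data.Bool.Properties using (⇔→≡; ∧-identityʳ; ∧-zeroʳ)
open import Data.Bool.ListAction using (all)
open import Data.List as List using (List; []; _∷_; length; filter; _[_]∷=_)
open import Data.List.Properties using (filter-all)
open import Data.List.Relation.Unary.All as All using (All; []; _∷_)
open import Data.List.Relation.Unary.All.Properties using (all-filter; filter⁺; map⁺)
open import Data.List.Relation.Unary.AllPairs using ([]; _∷_)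
open import Data.List.Relation.Unary.Unique.Propositional using (Unique)
import Data.List.Relation.Unary.Unique.Propositional.Properties as Unique
open import Data.List.Membership.Propositional using (_∈_)
open import Data.List.Membership.Propositional.Properties using (∈-lookup)
open import Data.Maybe using (Maybe; just; nothing)
open import Data.Maybe.Properties using (just-injective)
open import Data.Vec using (Vec; _++_; map; lookup; tabulate; take; drop)
open import Data.Vec.Properties
  using (map-++; map-∘; map-cong; map-id; lookup-map; lookup∘tabulate; tabulate-∘; tabulate-cong; take++drop≡id; ++-injective)
open import Data.Vec.Functional using () renaming (_++_ to _⊕_)
open import Data.Vec.Functional.Properties using (lookup-++ˡ; lookup-++ʳ)
open import Data.Product using (Σ; _×_; _,_; proj₁; proj₂)
open import Data.Sum using (_⊎_; inj₁; inj₂)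
open import Data.Unit using (⊤; tt)
open import Data.Empty using (⊥; ⊥-elim)
open import Function using (_∘_; id; const)
open import Function.Bundles using (mk⇔)
open import Relation.Nullary using (yes; no; contradiction)
open import Relation.Unary using (Decidable)
open import Relation.Binary.PropositionalEquality using (_≡_; refl; sym; trans; cong; cong₂; subst; module ≡-Reasoning)

∷=-lookup : ∀ {A : Set} (xs : List A) (k : Fin (length xs)) → xs [ k ]∷= List.lookup xs k ≡ xs
∷=-lookup (x ∷ xs) zero    = refl
∷=-lookup (x ∷ xs) (suc k) = cong (x ∷_) (∷=-lookup xs k)

bound : ∀ {a m n} {𝔸 : Struct a} → Sym 𝔸 m n → n ≤ m
bound (idb le _) = le
bound (edb _ le) = le

∧-agree : ∀ {b₁ b₂ : Bool} c → (c ≡ true → b₁ ≡ b₂) → b₁ ∧ c ≡ b₂ ∧ c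
∧-agree {b₁} {b₂} true  agree = trans (∧-identityʳ b₁) (trans (agree refl) (sym (∧-identityʳ b₂)))
∧-agree {b₁} {b₂} false _     = trans (∧-zeroʳ b₁) (sym (∧-zeroʳ b₂))

_⊗_ : ∀ {a r n} → Rel a r → Rel a n → Rel a (r + n)
_⊗_ {r = r} M U v = M (take r v) ∧ U (drop r v)

⊗-++ : ∀ {a r n} (M : Rel a r) (U : Rel a n) u w → (M ⊗ U) (u ++ w) ≡ M u ∧ U w
⊗-++ {r = r} M U u w with ++-injective (take r (u ++ w)) u (take++drop≡id r (u ++ w))
... | take≡u , drop≡w = cong₂ _∧_ (cong M take≡u) (cong U drop≡w)

module _ {a : ℕ} (𝔸 : Struct a) where

  data IsEDB {r Y} : Atom 𝔸 r Y → Set where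
    isEDB : ∀ {i le σ} → IsEDB (edb i le ⟨ σ ⟩)

  isEDB? : ∀ {r Y} → Decidable (IsEDB {r} {Y})
  isEDB? (idb _ _ ⟨ _ ⟩) = no λ ()
  isEDB? (edb _ _ ⟨ _ ⟩) = yes isEDB

  idb-not-edb : ∀ {r Y} {z : Atom 𝔸 r Y} → IsIDB 𝔸 z → IsEDB z → ⊥
  idb-not-edb isIDB ()

  rename-idb : ∀ {r Y Z} {ω : Y → Z} {z : Atom 𝔸 r Y} → IsIDB 𝔸 z → IsIDB 𝔸 (rename 𝔸 ω z)
  rename-idb isIDB = isIDB

  rename-edb : ∀ {r Y Z} {ω : Y → Z} {z : Atom 𝔸 r Y} → IsEDB z → IsEDB (rename 𝔸 ω z)
  rename-edb isEDB = isEDB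

  edbs : ∀ {r Y} → List (Atom 𝔸 r Y) → List (Atom 𝔸 r Y)
  edbs = filter isEDB?

  eval : ∀ {r} → (Fin r → Fin a) → Atom 𝔸 r (Fin r) → Bool
  eval f (S ⟨ σ ⟩) = ⟦_⟧ 𝔸 S (map f σ)

  holds⇒eval : ∀ {r} {f : Fin r → Fin a} z → Holds 𝔸 f z → eval f z ≡ true
  holds⇒eval (_ ⟨ _ ⟩) p = p

  eval⇒holds : ∀ {r} {f : Fin r → Fin a} z → eval f z ≡ true → Holds 𝔸 f z
  eval⇒holds (_ ⟨ _ ⟩) p = p

  All-holds⇒all : ∀ {r} {f : Fin r → Fin a} {E} → All (Holds 𝔸 f) E → all (eval f) E ≡ true
  All-holds⇒all [] = refl
  All-holds⇒all {E = z ∷ _} (p ∷ ps) rewrite holds⇒eval z p = All-holds⇒all ps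

  all⇒All-holds : ∀ {r} {f : Fin r → Fin a} E → all (eval f) E ≡ true → All (Holds 𝔸 f) E
  all⇒All-holds [] _ = []
  all⇒All-holds {f = f} (z ∷ E) p with eval f z in e
  ... | true  = eval⇒holds z e ∷ all⇒All-holds E p
  ... | false = contradiction p λ ()

  Agree : ∀ {r} → Atom 𝔸 r (Fin r) → Atom 𝔸 r (Fin r) → List (Atom 𝔸 r (Fin r)) → Set
  Agree h c E = ∀ f → all (eval f) E ≡ true → eval f c ≡ eval f h

  no-idb⇒edbs : ∀ {r Y} (B : List (Atom 𝔸 r Y)) → nIDB 𝔸 B ≤ 0 → All IsEDB B
  no-idb⇒edbs []                   _  = []
  no-idb⇒edbs (idb _ _ ⟨ _ ⟩ ∷ B) ()
  no-idb⇒edbs (edb _ _ ⟨ _ ⟩ ∷ B) le = isEDB ∷ no-idb⇒edbs B le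

  edbs⇒no-idb : ∀ {r Y} {B : List (Atom 𝔸 r Y)} → All IsEDB B → nIDB 𝔸 B ≤ 0
  edbs⇒no-idb []           = z≤n
  edbs⇒no-idb (isEDB ∷ es) = edbs⇒no-idb es

  -- Agreement makes
  -- both the rule and its swap consistent, so it belongs to the program.
  linkRule : ∀ {r} (h c : Atom 𝔸 r (Fin r)) (E : List (Atom 𝔸 r (Fin r))) →
             IsIDB 𝔸 h → IsIDB 𝔸 c → All IsEDB E → Unique E → Agree h c E → Rule 𝔸 r
  linkRule h c E h-idb c-idb E-edb E-unique agree = record
    { head            = h
    ; body            = c ∷ E
    ; head-idb        = h-idb
    ; one-idb         = single-idb c-idb
    ; distinct        = All.map (λ e c≡z → idb-not-edb (subst (IsIDB 𝔸) c≡z c-idb) e) E-edb ∷ E-unique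
    ; consistent      = λ { f (pc ∷ pE) →
        eval⇒holds h (trans (sym (agree f (All-holds⇒all pE))) (holds⇒eval c pc)) }
    ; swap-consistent = swap
    }
    where
    single-idb : IsIDB 𝔸 c → nIDB 𝔸 (c ∷ E) ≤ 1
    single-idb isIDB = s≤s (edbs⇒no-idb E-edb)

    swap : (k : Fin (length (c ∷ E))) → IsIDB 𝔸 (List.lookup (c ∷ E) k) →
           Consistent 𝔸 (List.lookup (c ∷ E) k) ((c ∷ E) [ k ]∷= h)
    swap zero    _    f (ph ∷ pE) =
      eval⇒holds c (trans (agree f (All-holds⇒all pE)) (holds⇒eval h ph))
    swap (suc k) k-idb = ⊥-elim (idb-not-edb k-idb (All.lookup E-edb (∈-lookup k)))

  axiomRule : ∀ {r} (h : Atom 𝔸 r (Fin r)) → IsIDB 𝔸 h → (∀ f → eval f h ≡ true) → Rule 𝔸 r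
  axiomRule h h-idb valid = record
    { head = h ; body = [] ; head-idb = h-idb ; one-idb = z≤n ; distinct = []
    ; consistent = λ f _ → eval⇒holds h (valid f) ; swap-consistent = λ () }

  data Premise {r} (ρ : Rule 𝔸 r) : Set where
    axiom : (∀ f → all (eval f) (edbs (body ρ)) ≡ true → eval f (head ρ) ≡ true) → Premise ρ
    link  : ∀ {y} → y ∈ body ρ → IsIDB 𝔸 y → Agree (head ρ) y (edbs (body ρ)) → Premise ρ

  idb-position : ∀ {r Y} (B : List (Atom 𝔸 r Y)) →
                 All IsEDB B ⊎ Σ (Fin (length B)) (IsIDB 𝔸 ∘ List.lookup B)
  idb-position []                   = inj₁ []
  idb-position (idb _ _ ⟨ _ ⟩ ∷ B) = inj₂ (zero , isIDB)
  idb-position (edb _ _ ⟨ _ ⟩ ∷ B) with idb-position B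
  ... | inj₁ es      = inj₁ (isEDB ∷ es)
  ... | inj₂ (k , p) = inj₂ (suc k , p)

  fill : ∀ {r Y} {P : Atom 𝔸 r Y → Set} (B : List (Atom 𝔸 r Y)) (k : Fin (length B)) →
         IsIDB 𝔸 (List.lookup B k) → nIDB 𝔸 B ≤ 1 →
         ∀ {x} → P x → All P (edbs B) → All P (B [ k ]∷= x)
  fill (idb _ _ ⟨ _ ⟩ ∷ B) zero    _     (s≤s none) px pB =
    px ∷ subst (All _) (filter-all isEDB? (no-idb⇒edbs B none)) pB
  fill (idb _ _ ⟨ _ ⟩ ∷ B) (suc k) k-idb (s≤s none) =
    ⊥-elim (idb-not-edb k-idb (All.lookup (no-idb⇒edbs B none) (∈-lookup k)))
  fill (edb _ _ ⟨ _ ⟩ ∷ B) (suc k) k-idb one px (pz ∷ pB) = pz ∷ fill B k k-idb one px pB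

  -- Consistency of ρ gives one direction of the agreement, swap-consistency
  -- the other.
  premise : ∀ {r} (ρ : Rule 𝔸 r) → Premise ρ
  premise {r} ρ with idb-position (body ρ)
  ... | inj₁ all-edb = axiom λ f p → holds⇒eval (head ρ) (consistent ρ f
          (subst (All (Holds 𝔸 f)) (filter-all isEDB? all-edb) (all⇒All-holds _ p)))
  ... | inj₂ (k , k-idb) = link (∈-lookup k) k-idb agree
    where
    y : Atom 𝔸 r (Fin r)
    y = List.lookup (body ρ) k

    body-with : ∀ f {x} → Holds 𝔸 f x → all (eval f) (edbs (body ρ)) ≡ true →
                All (Holds 𝔸 f) (body ρ [ k ]∷= x)
    body-with f hx p = fill (body ρ) k k-idb (one-idb ρ) hx (all⇒All-holds _ p)

    agree : Agree (head ρ) y (edbs (body ρ))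
    agree f p = ⇔→≡ (mk⇔
      (λ hy → holds⇒eval (head ρ) (consistent ρ f
                (subst (All (Holds 𝔸 f)) (∷=-lookup (body ρ) k) (body-with f (eval⇒holds y hy) p))))
      (λ hh → holds⇒eval y (swap-consistent ρ k k-idb f (body-with f (eval⇒holds (head ρ) hh) p))))

  FromConstraint : ∀ {X r} → Instance 𝔸 X → Atom 𝔸 r X → Set
  FromConstraint I (idb _ _ ⟨ _ ⟩) = ⊤
  FromConstraint I (edb i _ ⟨ ν ⟩) = (i , ν) ∈ cons I

  from-constraint : ∀ {X r} {I : Instance 𝔸 X} {z} → Derives 𝔸 I r z → FromConstraint I z
  from-constraint (base _ mem) = mem
  from-constraint (apply ρ ω _ _) with head ρ | head-idb ρ
  ... | _ | isIDB = tt

-- Rules of width t = r + s over variables split into an x-block (Fin r)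
-- and a y-block (Fin s).  The x-block is mapped to fixed values χ; x0 and y0
-- witness that both blocks are nonempty.
module Layout {a : ℕ} (𝔸 : Struct a) {X : Set} (I : Instance 𝔸 X) (r s : ℕ) (x0 : Fin r) (y0 : Fin s)
              (χ : Fin r → X) (χ-ok : ∀ i → χ i ∈ vars I) where

  t : ℕ
  t = r + s

  xv : Fin r → Fin t
  xv i = i ↑ˡ s

  yv : Fin s → Fin t
  yv j = r ↑ʳ j

  xs : Vec (Fin t) r
  xs = tabulate xv

  -- a left inverse of yv, used to show that moved atoms stay distinct
  unyv : Fin t → Fin s
  unyv = (λ _ → y0) ⊕ id

  ⊕-ok : ∀ {η : Fin s → X} → (∀ j → η j ∈ vars I) → ∀ k → (χ ⊕ η) k ∈ vars I
  ⊕-ok η-ok k with splitAt r k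
  ... | inj₁ i = χ-ok i
  ... | inj₂ j = η-ok j

  -- a filler for the y-block when it is not used
  η₀ : Fin s → X
  η₀ _ = χ x0

  η₀-ok : ∀ j → η₀ j ∈ vars I
  η₀-ok _ = χ-ok x0

  map-xs : ∀ (η : Fin s → X) → map (χ ⊕ η) xs ≡ tabulate χ
  map-xs η = trans (sym (tabulate-∘ (χ ⊕ η) xv)) (tabulate-cong (lookup-++ˡ χ η))

  map-xv : ∀ (η : Fin s → X) {n} (σ : Vec (Fin r) n) → map (χ ⊕ η) (map xv σ) ≡ map χ σ
  map-xv η σ = trans (sym (map-∘ (χ ⊕ η) xv σ)) (map-cong (lookup-++ˡ χ η) σ)

  map-yv : ∀ (η : Fin s → X) {n} (σ : Vec (Fin s) n) → map (χ ⊕ η) (map yv σ) ≡ map η σ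
  map-yv η σ = trans (sym (map-∘ (χ ⊕ η) yv σ)) (map-cong (lookup-++ʳ χ η) σ)

  map-xv-lookup : ∀ (f : Fin t → Fin a) {n} (σ : Vec (Fin r) n) → map f (map xv σ) ≡ map (lookup (map f xs)) σ
  map-xv-lookup f σ = trans (sym (map-∘ f xv σ)) (map-cong lookup-xs σ)
    where
    lookup-xs : ∀ i → f (xv i) ≡ lookup (map f xs) i
    lookup-xs i = sym (trans (lookup-map i f xs) (cong f (lookup∘tabulate xv i)))

  onX : Rel a r → Atom 𝔸 t (Fin t)
  onX M = idb (m≤m+n r s) M ⟨ xs ⟩

  onχ : Rel a r → Atom 𝔸 t X
  onχ M = idb (m≤m+n r s) M ⟨ tabulate χ ⟩

  via : ∀ {z z′} → z ≡ z′ → Derives 𝔸 I t z → Derives 𝔸 I t z′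
  via = subst (Derives 𝔸 I t)

  rename-onX : ∀ η M → rename 𝔸 (χ ⊕ η) (onX M) ≡ onχ M
  rename-onX η M = cong (idb (m≤m+n r s) M ⟨_⟩) (map-xs η)

  s≤t : s ≤ t
  s≤t = m≤n+m s r

  widen : ∀ {n} → Sym 𝔸 s n → Sym 𝔸 t n
  widen (idb le R) = idb (≤-trans le s≤t) R
  widen (edb i le) = edb i (≤-trans le s≤t)

  embed : Atom 𝔸 s (Fin s) → Atom 𝔸 t (Fin t)
  embed (S ⟨ σ ⟩) = widen S ⟨ map yv σ ⟩

  embedχ : Atom 𝔸 s X → Atom 𝔸 t X
  embedχ (S ⟨ ν ⟩) = widen S ⟨ ν ⟩

  rename-embed : ∀ η z → rename 𝔸 (χ ⊕ η) (embed z) ≡ embedχ (rename 𝔸 η z)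
  rename-embed η (S ⟨ σ ⟩) = cong (widen S ⟨_⟩) (map-yv η σ)

  eval-embed : ∀ f z → eval 𝔸 f (embed z) ≡ eval 𝔸 (f ∘ yv) z
  eval-embed f (idb _ R ⟨ σ ⟩) = cong R (sym (map-∘ f yv σ))
  eval-embed f (edb i _ ⟨ σ ⟩) = cong (basic 𝔸 i) (sym (map-∘ f yv σ))

  all-embed : ∀ f E → all (eval 𝔸 f) (List.map embed E) ≡ all (eval 𝔸 (f ∘ yv)) E
  all-embed f []      = refl
  all-embed f (z ∷ E) = cong₂ _∧_ (eval-embed f z) (all-embed f E)

  embed-edb : ∀ {z} → IsEDB 𝔸 z → IsEDB 𝔸 (embed z)
  embed-edb isEDB = isEDB

  -- embed has a partial left inverse, so it is injective.
  narrow : Atom 𝔸 t (Fin t) → Maybe (Atom 𝔸 s (Fin s))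
  narrow (idb {n} _ R ⟨ w ⟩) with n ≤? s
  ... | yes le = just (idb le R ⟨ map unyv w ⟩)
  ... | no _   = nothing
  narrow (edb i _ ⟨ w ⟩) with arity 𝔸 i ≤? s
  ... | yes le = just (edb i le ⟨ map unyv w ⟩)
  ... | no _   = nothing

  unyv-yv : ∀ {n} (σ : Vec (Fin s) n) → map unyv (map yv σ) ≡ σ
  unyv-yv σ = trans (sym (map-∘ unyv yv σ)) (trans (map-cong (lookup-++ʳ {m = r} (λ _ → y0) id) σ) (map-id σ))

  narrow-embed : ∀ z → narrow (embed z) ≡ just z
  narrow-embed (idb {n} le R ⟨ σ ⟩) with n ≤? s
  ... | yes le′ = cong₂ (λ p w → just (idb p R ⟨ w ⟩)) (≤-irrelevant le′ le) (unyv-yv σ)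
  ... | no ¬le  = contradiction le ¬le
  narrow-embed (edb i le ⟨ σ ⟩) with arity 𝔸 i ≤? s
  ... | yes le′ = cong₂ (λ p w → just (edb i p ⟨ w ⟩)) (≤-irrelevant le′ le) (unyv-yv σ)
  ... | no ¬le  = contradiction le ¬le

  embed-injective : ∀ {z z′} → embed z ≡ embed z′ → z ≡ z′
  embed-injective {z} {z′} eq =
    just-injective (trans (sym (narrow-embed z)) (trans (cong narrow eq) (narrow-embed z′)))

  widen-derivation : ∀ {z} → Derives 𝔸 I s z → IsEDB 𝔸 z → Derives 𝔸 I t (embedχ z)
  widen-derivation d isEDB = base _ (from-constraint 𝔸 d)

  sides : ∀ (ρ : Rule 𝔸 s) → List (Atom 𝔸 t (Fin t))
  sides ρ = List.map embed (edbs 𝔸 (body ρ))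

  sides-edb : ∀ ρ → All (IsEDB 𝔸) (sides ρ)
  sides-edb ρ = map⁺ (All.map embed-edb (all-filter (isEDB? 𝔸) (body ρ)))

  sides-unique : ∀ ρ → Unique (sides ρ)
  sides-unique ρ = Unique.map⁺ embed-injective (Unique.filter⁺ (isEDB? 𝔸) (distinct ρ))

  sides-derived : ∀ ρ {η : Fin s → X} → All (λ z → Derives 𝔸 I s (rename 𝔸 η z)) (body ρ) →
                  All (λ z → Derives 𝔸 I t (rename 𝔸 (χ ⊕ η) z)) (sides ρ)
  sides-derived ρ {η} ds = map⁺ (All.zipWith moved (filter⁺ (isEDB? 𝔸) ds , all-filter (isEDB? 𝔸) (body ρ)))
    where
    moved : ∀ {z} → Derives 𝔸 I s (rename 𝔸 η z) × IsEDB 𝔸 z →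
            Derives 𝔸 I t (rename 𝔸 (χ ⊕ η) (embed z))
    moved {z} (d , e) = via (sym (rename-embed η z)) (widen-derivation d (rename-edb 𝔸 e))

  edbs-hold : ∀ (ρ : Rule 𝔸 s) f → all (eval 𝔸 f) (sides ρ) ≡ true →
              all (eval 𝔸 (f ∘ yv)) (edbs 𝔸 (body ρ)) ≡ true
  edbs-hold ρ f p = trans (sym (all-embed f (edbs 𝔸 (body ρ)))) p

  link-step : ∀ (ρ : Rule 𝔸 s) {η : Fin s → X} → (∀ j → η j ∈ vars I) →
              All (λ z → Derives 𝔸 I s (rename 𝔸 η z)) (body ρ) →
              ∀ h c → IsIDB 𝔸 h → IsIDB 𝔸 c → Agree 𝔸 h c (sides ρ) →
              Derives 𝔸 I t (rename 𝔸 (χ ⊕ η) c) → Derives 𝔸 I t (rename 𝔸 (χ ⊕ η) h)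
  link-step ρ {η} η-ok ds h c h-idb c-idb agree dc =
    apply (linkRule 𝔸 h c (sides ρ) h-idb c-idb (sides-edb ρ) (sides-unique ρ) agree)
          (χ ⊕ η) (⊕-ok η-ok) (dc ∷ sides-derived ρ ds)

  module Passenger (M : Rel a r) where

    carry : Atom 𝔸 s (Fin s) → Atom 𝔸 t (Fin t)
    carry (S ⟨ σ ⟩) = idb (+-monoʳ-≤ r (bound S)) (M ⊗ ⟦_⟧ 𝔸 S) ⟨ xs ++ map yv σ ⟩

    carryχ : Atom 𝔸 s X → Atom 𝔸 t X
    carryχ (S ⟨ ν ⟩) = idb (+-monoʳ-≤ r (bound S)) (M ⊗ ⟦_⟧ 𝔸 S) ⟨ tabulate χ ++ ν ⟩

    carry-idb : ∀ z → IsIDB 𝔸 (carry z)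
    carry-idb (_ ⟨ _ ⟩) = isIDB

    rename-carry : ∀ η z → rename 𝔸 (χ ⊕ η) (carry z) ≡ carryχ (rename 𝔸 η z)
    rename-carry η (S ⟨ σ ⟩) = cong (idb (+-monoʳ-≤ r (bound S)) (M ⊗ ⟦_⟧ 𝔸 S) ⟨_⟩)
      (trans (map-++ (χ ⊕ η) xs (map yv σ)) (cong₂ _++_ (map-xs η) (map-yv η σ)))

    eval-carry : ∀ f z → eval 𝔸 f (carry z) ≡ M (map f xs) ∧ eval 𝔸 (f ∘ yv) z
    eval-carry f (_⟨_⟩ {n} S σ) = begin
      (M ⊗ U) (map f (xs ++ map yv σ))        ≡⟨ cong (M ⊗ U) (map-++ f xs (map yv σ)) ⟩
      (M ⊗ U) (map f xs ++ map f (map yv σ))  ≡⟨ ⊗-++ M U (map f xs) _ ⟩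
      M (map f xs) ∧ U (map f (map yv σ))     ≡⟨ cong (λ v → M (map f xs) ∧ U v) (map-∘ f yv σ) ⟨
      M (map f xs) ∧ U (map (f ∘ yv) σ)       ∎
      where
      U : Rel a n
      U = ⟦_⟧ 𝔸 S
      open ≡-Reasoning

    carry-link : ∀ ρ y → Agree 𝔸 (head ρ) y (edbs 𝔸 (body ρ)) →
                 Agree 𝔸 (carry (head ρ)) (carry y) (sides ρ)
    carry-link ρ y agree f p = begin
      eval 𝔸 f (carry y)                       ≡⟨ eval-carry f y ⟩
      M (map f xs) ∧ eval 𝔸 (f ∘ yv) y        ≡⟨ cong (M (map f xs) ∧_) (agree (f ∘ yv) (edbs-hold ρ f p)) ⟩
      M (map f xs) ∧ eval 𝔸 (f ∘ yv) (head ρ) ≡⟨ eval-carry f (head ρ) ⟨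
      eval 𝔸 f (carry (head ρ))                ∎
      where open ≡-Reasoning

    carry-axiom : ∀ ρ → (∀ g → all (eval 𝔸 g) (edbs 𝔸 (body ρ)) ≡ true → eval 𝔸 g (head ρ) ≡ true) →
                  Agree 𝔸 (carry (head ρ)) (onX M) (sides ρ)
    carry-axiom ρ valid f p = begin
      M (map f xs)                             ≡⟨ ∧-identityʳ _ ⟨
      M (map f xs) ∧ true                      ≡⟨ cong (M (map f xs) ∧_) (valid (f ∘ yv) (edbs-hold ρ f p)) ⟨
      M (map f xs) ∧ eval 𝔸 (f ∘ yv) (head ρ) ≡⟨ eval-carry f (head ρ) ⟨
      eval 𝔸 f (carry (head ρ))                ∎
      where open ≡-Reasoning

    -- Replay the derivation of z with M carried along: an axiom of width s
    -- becomes a link from M, a link rule a link between carried atoms.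
    mutual
      forward : ∀ {z} → Derives 𝔸 I s z → IsIDB 𝔸 z →
                Derives 𝔸 I t (onχ M) → Derives 𝔸 I t (carryχ z)
      forward (base _ _) ()
      forward (apply ρ η η-ok ds) _ dM with premise 𝔸 ρ
      ... | axiom valid =
        via (rename-carry η (head ρ))
            (link-step ρ η-ok ds (carry (head ρ)) (onX M) (carry-idb _) isIDB (carry-axiom ρ valid)
               (via (sym (rename-onX η M)) dM))
      ... | link {y} y∈ y-idb agree =
        via (rename-carry η (head ρ))
            (link-step ρ η-ok ds (carry (head ρ)) (carry y) (carry-idb _) (carry-idb _) (carry-link ρ y agree)
               (via (sym (rename-carry η y)) (All.lookup (forward-all ds) y∈ (rename-idb 𝔸 y-idb) dM)))

      forward-all : ∀ {η : Fin s → X} {B} → All (λ z → Derives 𝔸 I s (rename 𝔸 η z)) B →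
                    All (λ z → IsIDB 𝔸 (rename 𝔸 η z) → Derives 𝔸 I t (onχ M) →
                               Derives 𝔸 I t (carryχ (rename 𝔸 η z))) B
      forward-all []       = []
      forward-all (d ∷ ds) = forward d ∷ forward-all ds

    -- The same replay in reverse, through the swapped links.
    mutual
      backward : ∀ {z} → Derives 𝔸 I s z → IsIDB 𝔸 z →
                 Derives 𝔸 I t (carryχ z) → Derives 𝔸 I t (onχ M)
      backward (base _ _) ()
      backward (apply ρ η η-ok ds) _ dC with premise 𝔸 ρ
      ... | axiom valid =
        via (rename-onX η M)
            (link-step ρ η-ok ds (onX M) (carry (head ρ)) isIDB (carry-idb _)
               (λ f p → sym (carry-axiom ρ valid f p))
               (via (sym (rename-carry η (head ρ))) dC))
      ... | link {y} y∈ y-idb agree =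
        All.lookup (backward-all ds) y∈ (rename-idb 𝔸 y-idb)
          (via (rename-carry η y)
               (link-step ρ η-ok ds (carry y) (carry (head ρ)) (carry-idb _) (carry-idb _)
                  (λ f p → sym (carry-link ρ y agree f p))
                  (via (sym (rename-carry η (head ρ))) dC)))

      backward-all : ∀ {η : Fin s → X} {B} → All (λ z → Derives 𝔸 I s (rename 𝔸 η z)) B →
                     All (λ z → IsIDB 𝔸 (rename 𝔸 η z) → Derives 𝔸 I t (carryχ (rename 𝔸 η z)) →
                                Derives 𝔸 I t (onχ M)) B
      backward-all []       = []
      backward-all (d ∷ ds) = backward d ∷ backward-all ds

  module _ {n} (le : n ≤ s) (U : Rel a n) (σ : Vec (Fin r) n) where

    pair : Rel a r → Atom 𝔸 t (Fin t)
    pair M = idb (+-monoʳ-≤ r le) (M ⊗ U) ⟨ xs ++ map xv σ ⟩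

    rename-pair : ∀ M → rename 𝔸 (χ ⊕ η₀) (pair M) ≡ Passenger.carryχ M (idb le U ⟨ map χ σ ⟩)
    rename-pair M = cong (idb (+-monoʳ-≤ r le) (M ⊗ U) ⟨_⟩)
      (trans (map-++ (χ ⊕ η₀) xs (map xv σ)) (cong₂ _++_ (map-xs η₀) (map-xv η₀ σ)))

    eval-pair : ∀ M f → eval 𝔸 f (pair M) ≡ M (map f xs) ∧ U (map (lookup (map f xs)) σ)
    eval-pair M f = trans (cong (M ⊗ U) (map-++ f xs (map xv σ)))
      (trans (⊗-++ M U (map f xs) _) (cong (λ w → M (map f xs) ∧ U w) (map-xv-lookup f σ)))

    switch : ∀ M₁ M₂ → (∀ v → U (map (lookup v) σ) ≡ true → M₁ v ≡ M₂ v) →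
             Derives 𝔸 I t (Passenger.carryχ M₁ (idb le U ⟨ map χ σ ⟩)) →
             Derives 𝔸 I t (Passenger.carryχ M₂ (idb le U ⟨ map χ σ ⟩))
    switch M₁ M₂ agree d =
      via (rename-pair M₂)
        (apply (linkRule 𝔸 (pair M₂) (pair M₁) [] isIDB isIDB [] [] pair-agree) (χ ⊕ η₀) (⊕-ok η₀-ok)
               (via (sym (rename-pair M₁)) d ∷ []))
      where
      pair-agree : Agree 𝔸 (pair M₂) (pair M₁) []
      pair-agree f _ = trans (eval-pair M₁ f) (trans (∧-agree _ (agree (map f xs))) (sym (eval-pair M₂ f)))

    transfer : ∀ M₁ M₂ → Derives 𝔸 I s (idb le U ⟨ map χ σ ⟩) →
               (∀ v → U (map (lookup v) σ) ≡ true → M₁ v ≡ M₂ v) →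
               Derives 𝔸 I t (onχ M₁) → Derives 𝔸 I t (onχ M₂)
    transfer M₁ M₂ dU agree =
      Passenger.backward M₂ dU isIDB ∘ switch M₁ M₂ agree ∘ Passenger.forward M₁ dU isIDB

module Simulation {a : ℕ} (𝔸 𝔹 : Struct a) {X : Set} (I : Instance 𝔸 X) (r s : ℕ) (x0 : Fin r) (y0 : Fin s)
                  (J : Instance 𝔹 X) (I⊢J : DerivesInst 𝔸 𝔹 I s J) where

  t : ℕ
  t = r + s

  asIDB : Atom 𝔹 r X → Atom 𝔸 t X
  asIDB (S ⟨ ν ⟩) = idb (≤-trans (bound S) (m≤m+n r s)) (⟦_⟧ 𝔹 S) ⟨ ν ⟩

  Simulated : Atom 𝔹 r X → Set
  Simulated z = IsIDB 𝔹 z → Derives 𝔸 I t (asIDB z)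

  module RuleStep (ρ : Rule 𝔹 r) (ω : Fin r → X) (ω-ok : ∀ i → ω i ∈ vars J) where

    open Layout 𝔸 I r s x0 y0 ω (λ i → proj₁ I⊢J _ (ω-ok i)) hiding (t)

    h : Atom 𝔹 r (Fin r)
    h = head ρ

    ⟪_⟫ : Atom 𝔹 r (Fin r) → Rel a r
    ⟪ z ⟫ v = eval 𝔹 (lookup v) z

    guarded : List (Atom 𝔹 r (Fin r)) → Rel a r → Rel a r
    guarded E P v = if all (λ z → ⟪ z ⟫ v) E then ⟪ h ⟫ v else P v

    guard-discharged : ∀ z E P v → ⟪ z ⟫ v ≡ true → guarded (z ∷ E) P v ≡ guarded E P v
    guard-discharged z E P v holds rewrite holds = refl

    lift : Atom 𝔹 r (Fin r) → Atom 𝔸 t (Fin t)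
    lift (S ⟨ σ ⟩) = idb (≤-trans (bound S) (m≤m+n r s)) (⟦_⟧ 𝔹 S) ⟨ map xv σ ⟩

    lift-idb : ∀ z → IsIDB 𝔸 (lift z)
    lift-idb (_ ⟨ _ ⟩) = isIDB

    rename-lift : ∀ z → rename 𝔸 (ω ⊕ η₀) (lift z) ≡ asIDB (rename 𝔹 ω z)
    rename-lift (S ⟨ σ ⟩) = cong (idb (≤-trans (bound S) (m≤m+n r s)) (⟦_⟧ 𝔹 S) ⟨_⟩) (map-xv η₀ σ)

    eval-lift : ∀ f z → eval 𝔸 f (lift z) ≡ ⟪ z ⟫ (map f xs)
    eval-lift f (S ⟨ σ ⟩) = cong (⟦_⟧ 𝔹 S) (map-xv-lookup f σ)

    relink : ∀ p q → IsIDB 𝔸 p → IsIDB 𝔸 q → Agree 𝔸 p q [] →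
             Derives 𝔸 I t (rename 𝔸 (ω ⊕ η₀) q) → Derives 𝔸 I t (rename 𝔸 (ω ⊕ η₀) p)
    relink p q p-idb q-idb agree dq =
      apply (linkRule 𝔸 p q [] p-idb q-idb [] [] agree) (ω ⊕ η₀) (⊕-ok η₀-ok) (dq ∷ [])

    -- Step 1.  The guarded relation for the EDB atoms of ρ is derivable at ω:
    -- with P ≡ true if ρ has no IDB premise, and P = ⟪ y ⟫ for its premise y.
    start : Premise 𝔹 ρ → All (Simulated ∘ rename 𝔹 ω) (body ρ) →
            Σ (Rel a r) λ P → Derives 𝔸 I t (onχ (guarded (edbs 𝔹 (body ρ)) P))
    start (axiom valid) _ = const true ,
      via (rename-onX η₀ _)
        (apply (axiomRule 𝔸 (onX _) isIDB (λ f → guarded-valid (map f xs))) (ω ⊕ η₀) (⊕-ok η₀-ok) [])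
      where
      guarded-valid : ∀ v → guarded (edbs 𝔹 (body ρ)) (const true) v ≡ true
      guarded-valid v with all (λ z → ⟪ z ⟫ v) (edbs 𝔹 (body ρ)) in holds
      ... | true  = valid (lookup v) holds
      ... | false = refl
    start (link {y} y∈ y-idb agree) ih = ⟪ y ⟫ ,
      via (rename-onX η₀ _)
        (relink (onX _) (lift y) isIDB (lift-idb y) (λ f _ → trans (eval-lift f y) (guarded-link (map f xs)))
           (via (sym (rename-lift y)) (All.lookup ih y∈ (rename-idb 𝔹 y-idb))))
      where
      guarded-link : ∀ v → ⟪ y ⟫ v ≡ guarded (edbs 𝔹 (body ρ)) ⟪ y ⟫ v
      guarded-link v with all (λ z → ⟪ z ⟫ v) (edbs 𝔹 (body ρ)) in holds
      ... | true  = agree (lookup v) holds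
      ... | false = refl

    -- Step 2.  Each guard is an EDB atom z of ρ; ω(z) is a constraint of J,
    -- hence an IDB fact of width s for I, and the transfer lemma removes it.
    peel : ∀ {P} E → All (IsEDB 𝔹) E → All (λ z → Derives 𝔹 J r (rename 𝔹 ω z)) E →
           Derives 𝔸 I t (onχ (guarded E P)) → Derives 𝔸 I t (onχ (guarded [] P))
    peel []      _ _ d = d
    peel {P} (edb j j≤r ⟨ σ ⟩ ∷ E) (isEDB ∷ es) (dz ∷ ds) d
      with All.lookup (proj₂ I⊢J) (from-constraint 𝔹 dz)
    ... | le , dU = peel E es ds
      (transfer le (basic 𝔹 j) σ (guarded (edb j j≤r ⟨ σ ⟩ ∷ E) P) (guarded E P) dU
         (guard-discharged (edb j j≤r ⟨ σ ⟩) E P) d)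

    -- Step 3.  Without guards the relation is the head of ρ itself.
    finish : ∀ {P} → Derives 𝔸 I t (onχ (guarded [] P)) → Derives 𝔸 I t (asIDB (rename 𝔹 ω h))
    finish d = via (rename-lift h)
      (relink (lift h) (onX ⟪ h ⟫) (lift-idb h) isIDB (λ f _ → sym (eval-lift f h))
         (via (sym (rename-onX η₀ ⟪ h ⟫)) d))

    simulate-rule : All (λ z → Derives 𝔹 J r (rename 𝔹 ω z)) (body ρ) →
                    All (Simulated ∘ rename 𝔹 ω) (body ρ) →
                    Derives 𝔸 I t (asIDB (rename 𝔹 ω h))
    simulate-rule ds ih with start (premise 𝔹 ρ) ih
    ... | P , d =
      finish {P} (peel (edbs 𝔹 (body ρ)) (all-filter (isEDB? 𝔹) (body ρ)) (filter⁺ (isEDB? 𝔹) ds) d)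

  mutual
    simulate : ∀ {z} → Derives 𝔹 J r z → Simulated z
    simulate (base _ _) ()
    simulate (apply ρ ω ω-ok ds) _ = RuleStep.simulate-rule ρ ω ω-ok ds (simulate-all ds)

    simulate-all : ∀ {ω : Fin r → X} {B} → All (λ z → Derives 𝔹 J r (rename 𝔹 ω z)) B →
                   All (Simulated ∘ rename 𝔹 ω) B
    simulate-all []       = []
    simulate-all (d ∷ ds) = simulate d ∷ simulate-all ds

lemma10 : ∀ {a : ℕ} (𝔸 𝔹 : Struct a) {X : Set} (I : Instance 𝔸 X)
          (r s : ℕ) → 0 < r → 0 < s → (J : Instance 𝔹 X) →
          DerivesInst 𝔸 𝔹 I s J → DerivesGoal 𝔹 J r →
          DerivesGoal 𝔸 I (r + s)
lemma10 𝔸 𝔹 I r s 0<r 0<s J I⊢J (n , le , R , empty , ρ , d) =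
  n , ≤-trans le (m≤m+n r s) , R , empty , ρ , simulate d isIDB
  where open Simulation 𝔸 𝔹 I r s (fromℕ< 0<r) (fromℕ< 0<s) J I⊢J
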